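{- In any Q-structure, for any facts $F,G$ and any $x\in\mathcal P$: $x\in F\multimap G$ iff $x\cdot h\in F^\perp$ for every $h\in G^\perp$.
   Context: A Q-structure is a tuple $\langle\mathcal P,\mathcal Z,\cdot,1\rangle$ with $\mathcal P$ a set, $\mathcal Z\subseteq\mathcal P$, $\cdot$ a binary operation on $\mathcal P$ (not assumed associative or commutative), and $1\in\mathcal P$. These satisfy, for all $x,y,z$: $x\cdot y\in\mathcal Z$ iff $y\cdot x\in\mathcal Z$; $(x\cdot y)\cdot z\in\mathcal Z$ iff $x\cdot(z\cdot y)\in\mathcal Z$; and $1\cdot x=x\cdot1=x$. For $A\subseteq\mathcal P$, $A^\perp=\{b: b\cdot a\in\mathcal Z\ \forall a\in A\}$. A fact is a subset $F$ with $F=(F^\perp)^\perp$. For $A,B\subseteq\mathcal P$, $A\cdot B=\{a\cdot b:a\in A,b\in B\}$. Linear implication on facts: $F\multimap G=(F\cdot G^\perp)^\perp$. -}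

module Defs where

open import Level using (Level; _⊔_; suc)
open import Data.Product using (Σ; ∃; _×_; _,_)
open import Relation.Binary.PropositionalEquality using (_≡_)

Subset : ∀ {a} (A : Set a) (ℓ : Level) → Set (a ⊔ suc ℓ)
Subset A ℓ = A → Set ℓ

_⇔_ : ∀ {a b} → Set a → Set b → Set (a ⊔ b)
A ⇔ B = (A → B) × (B → A)

_⊆_ : ∀ {a ℓ₁ ℓ₂} {A : Set a} → Subset A ℓ₁ → Subset A ℓ₂ → Set (a ⊔ ℓ₁ ⊔ ℓ₂)
S ⊆ T = ∀ x → S x → T x

_≐_ : ∀ {a ℓ₁ ℓ₂} {A : Set a} → Subset A ℓ₁ → Subset A ℓ₂ → Set (a ⊔ ℓ₁ ⊔ ℓ₂)
S ≐ T = (S ⊆ T) × (T ⊆ S)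

record QStructure (p z : Level) : Set (suc (p ⊔ z)) where
  field
    P     : Set p
    Z     : Subset P z
    _·_   : P → P → P
    one   : P
    Z-sym : ∀ x y → Z (x · y) ⇔ Z (y · x)
    Z-rot : ∀ x y w → Z ((x · y) · w) ⇔ Z (x · (w · y))
    one-l : ∀ x → one · x ≡ x
    one-r : ∀ x → x · one ≡ x

module QOps {p z} (Q : QStructure p z) where
  open QStructure Q

  _⊥ : ∀ {ℓ} → Subset P ℓ → Subset P (p ⊔ z ⊔ ℓ)
  (A ⊥) b = ∀ a → A a → Z (b · a)

  IsFact : ∀ {ℓ} → Subset P ℓ → Set (p ⊔ z ⊔ ℓ)
  IsFact F = F ≐ ((F ⊥) ⊥)

  _⊙_ : ∀ {ℓ₁ ℓ₂} → Subset P ℓ₁ → Subset P ℓ₂ → Subset P (p ⊔ ℓ₁ ⊔ ℓ₂)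
  (A ⊙ B) c = Σ P λ a → Σ P λ b → A a × B b × (a · b ≡ c)

  _⊸_ : ∀ {ℓ₁ ℓ₂} → Subset P ℓ₁ → Subset P ℓ₂ → Subset P (p ⊔ z ⊔ ℓ₁ ⊔ ℓ₂)
  F ⊸ G = (F ⊙ (G ⊥)) ⊥

{-# OPTIONS --safe #-}
module Submission where

open import Level using (Level)
open import Defs
open import Data.Product using (_,_; proj₁; proj₂)
open import Relation.Binary.PropositionalEquality using (refl; subst)

module _ {p z} (Q : QStructure p z) where
  open QStructure Q
  open QOps Q

  -- The rotation axiom Z((x·b)·a) ⇔ Z(x·(a·b)) moves b from the product onto x;
  -- no fact hypotheses are needed.
  ⊥-⊙-curry : ∀ {ℓ₁ ℓ₂} (A : Subset P ℓ₁) (B : Subset P ℓ₂) x →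
              ((A ⊙ B) ⊥) x ⇔ (∀ b → B b → (A ⊥) (x · b))
  ⊥-⊙-curry A B x = curry , uncurry
    where
    curry : ((A ⊙ B) ⊥) x → ∀ b → B b → (A ⊥) (x · b)
    curry x⊥AB b Bb a Aa = proj₂ (Z-rot x b a) (x⊥AB (a · b) (a , b , Aa , Bb , refl))

    uncurry : (∀ b → B b → (A ⊥) (x · b)) → ((A ⊙ B) ⊥) x
    uncurry xB⊥A c (a , b , Aa , Bb , ab≡c) =
      subst (λ c → Z (x · c)) ab≡c (proj₁ (Z-rot x b a) (xB⊥A b Bb a Aa))

lemma9 : ∀ {p z ℓ₁ ℓ₂ : Level} (Q : QStructure p z) →
    let open QStructure Q
        open QOps Q
    in (F : Subset P ℓ₁) (G : Subset P ℓ₂) → IsFact F → IsFact G →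
       ∀ x → (F ⊸ G) x ⇔ (∀ h → (G ⊥) h → (F ⊥) (x · h))
lemma9 Q F G _ _ = ⊥-⊙-curry Q F (QOps._⊥ Q G)
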